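{- Let $r\ge3$ and consider the Lie algebra of type $A_r$ with simple roots $\alpha_1,\dots,\alpha_r$. Let $I=\{i_1,\ldots,i_\ell\}$ be a set of pairwise nonconsecutive integers with $1<i_1<i_2<\cdots<i_\ell<r$, let $c_{i_1},\ldots,c_{i_\ell}$ be positive integers, and let $$\xi=\sum_{i=1}^r\alpha_i+\sum_{j=1}^{\ell}c_{i_j}\alpha_{i_j}.$$ Then $$\wp_q(\xi)=q^{m+1}(1+q)^{r-1-2\ell}(2+2q+q^2)^{\ell},\qquad\text{where } m=\sum_{j=1}^{\ell}c_{i_j}.$$
   Context: In type $A_r$ the positive roots are $\alpha_i+\alpha_{i+1}+\cdots+\alpha_j$ for $1\le i\le j\le r$. A decomposition of a weight $\xi$ is a function $n:\Phi^+\to\mathbb{Z}_{\ge0}$ with $\sum_\alpha n(\alpha)\alpha=\xi$, using $\sum_\alpha n(\alpha)$ positive roots. The $q$-analog of Kostant's partition function is $\wp_q(\xi)=\sum_k c_kq^k$ where $c_k$ is the number of decompositions of $\xi$ using exactly $k$ positive roots. -}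

module Defs where

open import Data.Nat using (ℕ; zero; suc; _+_; _*_; _≤_; _<_; _≤ᵇ_; _≡ᵇ_)
open import Data.Bool using (Bool; true; false; if_then_else_; _∧_)
open import Data.Fin using (Fin; toℕ)
open import Data.Nat.ListAction using (sum)
open import Data.List using (List; []; _∷_; map; length; concatMap; filter; allFin; zipWith; replicate; _++_)
open import Data.List.Relation.Unary.All using (All)
open import Data.List.Relation.Unary.Linked using (Linked)
open import Data.Vec as V using (Vec; tabulate; toList)
open import Data.Product using (_×_; _,_; Σ)
open import Relation.Binary.PropositionalEquality using (_≡_)
open import Function.Bundles using (_↔_)

-- Type A_r.  Simple root α_{p+1} is indexed by p : Fin r.
-- A weight (element of the root lattice, nonnegative part) is its
-- coordinate vector in the basis of simple roots: Vec ℕ r.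

-- Positive roots α_i + ... + α_j (i ≤ j) are encoded by the pair (i , j).
-- posRoots r enumerates all of them (each exactly once).
posRoots : (r : ℕ) → List (Fin r × Fin r)
posRoots r = concatMap (λ i → map (λ j → (i , j)) (filter (λ j → toℕ i Data.Nat.≤? toℕ j) (allFin r))) (allFin r)

rootCoeff : {r : ℕ} → Fin r × Fin r → Fin r → ℕ
rootCoeff (i , j) p = if (toℕ i ≤ᵇ toℕ p) ∧ (toℕ p ≤ᵇ toℕ j) then 1 else 0

-- A function n : Φ⁺ → ℕ, recorded as the vector of its values along posRoots r.
RootFun : ℕ → Set
RootFun r = Vec ℕ (length (posRoots r))

weightOf : {r : ℕ} → RootFun r → Vec ℕ r
weightOf {r} n = tabulate (λ p → sum (zipWith (λ α m → m * rootCoeff α p) (posRoots r) (toList n)))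

rootsUsed : {r : ℕ} → RootFun r → ℕ
rootsUsed {r} n = sum (toList {n = length (posRoots r)} n)

DecompWith : (r : ℕ) → Vec ℕ r → ℕ → Set
DecompWith r ξ k = Σ (RootFun r) (λ n → (weightOf {r} n ≡ ξ) × (rootsUsed {r} n ≡ k))

HasCard : Set → ℕ → Set
HasCard A N = Fin N ↔ A

-- Polynomials in q with ℕ coefficients, as coefficient lists (constant first).

Poly : Set
Poly = List ℕ

_⊕_ : Poly → Poly → Poly
[] ⊕ q = q
(a ∷ p) ⊕ [] = a ∷ p
(a ∷ p) ⊕ (b ∷ q) = (a + b) ∷ (p ⊕ q)

_⊛_ : Poly → Poly → Poly
[] ⊛ q = []
(a ∷ p) ⊛ q = map (a *_) q ⊕ (0 ∷ (p ⊛ q))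

_^ₚ_ : Poly → ℕ → Poly
p ^ₚ zero = 1 ∷ []
p ^ₚ suc n = p ⊛ (p ^ₚ n)

qPow : ℕ → Poly
qPow n = replicate n 0 ++ (1 ∷ [])

coeff : Poly → ℕ → ℕ
coeff [] k = 0
coeff (a ∷ p) zero = a
coeff (a ∷ p) (suc k) = coeff p k

-- The data of Proposition 3.2 (indices 1-based as in the paper).

NonconsecIncreasing : List ℕ → Set
NonconsecIncreasing = Linked (λ a b → a + 2 ≤ b)

cAt : List ℕ → List ℕ → ℕ → ℕ
cAt [] _ p = 0
cAt (_ ∷ _) [] p = 0
cAt (i ∷ is) (c ∷ cs) p = (if i ≡ᵇ p then c else 0) + cAt is cs p

xi : (r ℓ : ℕ) → Vec ℕ ℓ → Vec ℕ ℓ → Vec ℕ r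
xi r ℓ I c = tabulate (λ p → 1 + cAt (toList I) (toList c) (suc (toℕ p)))

-- Idea.  A function n : Φ⁺ → ℕ is stored as a triangular array whose row for position p
-- lists the multiplicities of the roots α_p + ⋯ + α_q.  A decomposition of ξ is then
-- built row by row from the left; what is left to count after some rows is a
-- "completion" of ξ, given the contribution of the roots started so far.  The first
-- entry 1 of ξ starts exactly one root; from then on exactly one root coming from the
-- left is "open", of unknown length.  The rest of ξ splits into blocks [1] and
-- [c + 2, 1] (an index i_j, followed by 1 by the gap condition), and passing such a block
-- with one open root is counted by 1 + q, resp. q^{c+1} (2 + 2q + q²).

module Submission where

open import Defs
open import Data.Nat using (ℕ; _+_; _*_; _∸_; _≤_; _<_)
open import Data.Vec using (Vec; toList)
open import Data.List using (_∷_; [])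
open import Data.Nat.ListAction using (sum)
open import Data.List.Relation.Unary.All using (All)

open import Data.Nat using (zero; suc; s≤s; z≤n; _≤ᵇ_; _≤?_; _≡ᵇ_; _≟_)
open import Data.Nat.Properties
open import Data.Nat.Solver using (module +-*-Solver)
open import Data.Nat.ListAction.Properties using (sum-++)
open import Data.Bool using (false; if_then_else_)
open import Data.Fin using (Fin; zero; suc; toℕ)
open import Data.Fin.Properties using (+↔⊎)
open import Data.List as L using (List; _++_; map; length; filter; allFin; concatMap)
open import Data.List.Properties
  using (map-tabulate; length-map; length-++; length-tabulate; filter-all; filter-accept; filter-reject;
         map-∘; concatMap-map; concatMap-cong; map-concatMap)
open import Data.List.Relation.Unary.All as All using ([]; _∷_; universal)
open import Data.List.Relation.Unary.Linked as Linked using (Linked; []; [-]; _∷_)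
open import Data.List.Relation.Unary.Linked.Properties using (Linked⇒All)
open import Data.Vec as V using ([]; _∷_; lookup; replicate; zipWith; take; drop)
open import Data.Vec.Properties
  using (∷-injectiveˡ; ∷-injectiveʳ; ≡-dec; zipWith-assoc; zipWith-identityˡ; zipWith-identityʳ; toList-++;
         take++drop≡id; ++-injective; tabulate∘lookup; tabulate-cong; length-toList; lookup-zipWith)
open import Data.Product using (_×_; _,_; Σ; proj₁; proj₂)
open import Data.Product.Algebra using (×-cong)
open import Data.Product.Function.Dependent.Propositional using (Σ-↔)
open import Data.Sum using (_⊎_; inj₁; inj₂)
open import Data.Sum.Algebra using (⊎-cong)
open import Data.Unit using (⊤; tt)
open import Data.Empty using (⊥; ⊥-elim)
open import Relation.Nullary using (¬_; yes; no)
open import Relation.Nullary.Decidable using (dec-true; dec-false)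
open import Relation.Binary.PropositionalEquality
open import Function using (id; _∘_)
open import Function.Bundles using (_↔_; mk↔ₛ′; Inverse)
open import Function.Properties.Inverse using (↔-refl; ↔-sym; ↔-trans)
open import Function.Related.TypeIsomorphisms using (Σ-distribˡ-⊎; ∃∃↔∃∃)
open import Axiom.UniquenessOfIdentityProofs using (UIP; module Decidable⇒UIP)

open +-*-Solver using (solve; _:=_; _:+_; _:*_; con)

infixr 2 _⟨↔⟩_
_⟨↔⟩_ : {A B C : Set} → A ↔ B → B ↔ C → A ↔ C
_⟨↔⟩_ = ↔-trans

≡⇒↔ : {A B : Set} → A ≡ B → A ↔ B
≡⇒↔ refl = ↔-refl

Σ-congʳ : {A : Set} {P Q : A → Set} → (∀ {a} → P a ↔ Q a) → Σ A P ↔ Σ A Q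
Σ-congʳ = Σ-↔ ↔-refl

≡-prop-↔ : {a b c d : ℕ} → (a ≡ b → c ≡ d) → (c ≡ d → a ≡ b) → (a ≡ b) ↔ (c ≡ d)
≡-prop-↔ f g = mk↔ₛ′ f g (λ _ → ≡-irrelevant _ _) (λ _ → ≡-irrelevant _ _)

drop-≡ : {a b : ℕ} {X : Set} → a ≡ b → ((a ≡ b) × X) ↔ X
drop-≡ e = mk↔ₛ′ proj₂ (e ,_) (λ _ → refl) (λ (e′ , x) → cong (_, x) (≡-irrelevant e e′))

Σ-singleton : {R : ℕ → Set} {b : ℕ} → Σ ℕ (λ x → (x ≡ b) × R x) ↔ R b
Σ-singleton {R} {b} = mk↔ₛ′ to (λ r → b , refl , r) (λ _ → refl) from∘to
  where
  to : Σ ℕ (λ x → (x ≡ b) × R x) → R b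
  to (x , refl , r) = r
  from∘to : (y : Σ ℕ (λ x → (x ≡ b) × R x)) → (b , refl , to y) ≡ y
  from∘to (x , refl , r) = refl

Σ-Fin-suc : {n : ℕ} (P : Fin (suc n) → Set) → Σ (Fin (suc n)) P ↔ (P zero ⊎ Σ (Fin n) (P ∘ suc))
Σ-Fin-suc P = mk↔ₛ′ (λ { (zero , p) → inj₁ p ; (suc j , p) → inj₂ (j , p) })
  (λ { (inj₁ p) → zero , p ; (inj₂ (j , p)) → suc j , p })
  (λ { (inj₁ p) → refl ; (inj₂ (j , p)) → refl })
  (λ { (zero , p) → refl ; (suc j , p) → refl })

Σ-Vec-suc : {n : ℕ} (P : Vec ℕ (suc n) → Set) →
  Σ (Vec ℕ (suc n)) P ↔ Σ ℕ (λ x → Σ (Vec ℕ n) (λ xs → P (x ∷ xs)))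
Σ-Vec-suc P = mk↔ₛ′ (λ { (x ∷ xs , p) → x , xs , p }) (λ (x , xs , p) → x ∷ xs , p)
  (λ _ → refl) (λ { (x ∷ xs , p) → refl })

⊎-dropˡ : {A B : Set} → ¬ A → (A ⊎ B) ↔ B
⊎-dropˡ ¬a = mk↔ₛ′ (λ { (inj₁ a) → ⊥-elim (¬a a) ; (inj₂ b) → b }) inj₂ (λ _ → refl)
  (λ { (inj₁ a) → ⊥-elim (¬a a) ; (inj₂ b) → refl })

⊎-dropʳ : {A B : Set} → ¬ B → (A ⊎ B) ↔ A
⊎-dropʳ ¬b = mk↔ₛ′ (λ { (inj₁ a) → a ; (inj₂ b) → ⊥-elim (¬b b) }) inj₁ (λ _ → refl)
  (λ { (inj₁ a) → refl ; (inj₂ b) → ⊥-elim (¬b b) })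

Σ-reindex : {A B : Set} {P : A → Set} → UIP A → (g : B → A) → (∀ {b b′} → g b ≡ g b′ → b ≡ b′) →
  (∀ a → P a → Σ B (λ b → g b ≡ a)) → Σ A P ↔ Σ B (P ∘ g)
Σ-reindex {A} {B} {P} uip g inj cover = mk↔ₛ′ to from to∘from from∘to
  where
  to : Σ A P → Σ B (P ∘ g)
  to (a , p) = proj₁ (cover a p) , subst P (sym (proj₂ (cover a p))) p
  from : Σ B (P ∘ g) → Σ A P
  from (b , p) = g b , p
  to∘from : ∀ y → to (from y) ≡ y
  to∘from (b , p) with cover (g b) p
  ... | b′ , e with inj e
  ... | refl rewrite uip e refl = refl
  from∘to : ∀ x → from (to x) ≡ x
  from∘to (a , p) with cover a p
  ... | b , refl = refl

-- A power series in q with coefficients in ℕ, given by its coefficient sequence.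
Series : Set
Series = ℕ → ℕ

unit : Series
unit zero = 1
unit (suc k) = 0

shift : Series → Series
shift f zero = 0
shift f (suc k) = f k

shiftBy : ℕ → Series → Series
shiftBy zero f k = f k
shiftBy (suc n) f zero = 0
shiftBy (suc n) f (suc k) = shiftBy n f k

-- Reducing polynomial identities to identities of
-- this action avoids developing the ring of polynomials.
act : Poly → Series → Series
act [] f k = 0
act (x ∷ p) f k = x * f k + shift (act p f) k

shift-cong : {f g : Series} → f ≗ g → shift f ≗ shift g
shift-cong e zero = refl
shift-cong e (suc k) = e k

shift-zero : shift (λ _ → 0) ≗ λ _ → 0
shift-zero zero = refl
shift-zero (suc k) = refl

shift-additive : {h f g : Series} → (∀ k → h k ≡ f k + g k) → ∀ k → shift h k ≡ shift f k + shift g k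
shift-additive e zero = refl
shift-additive e (suc k) = e k

shift-linear : {h f g : Series} (x : ℕ) → (∀ k → h k ≡ x * f k + g k) →
  ∀ k → shift h k ≡ x * shift f k + shift g k
shift-linear x e zero = sym (cong (_+ 0) (*-zeroʳ x))
shift-linear x e (suc k) = e k

act-cong : (p : Poly) {f g : Series} → f ≗ g → act p f ≗ act p g
act-cong [] e k = refl
act-cong (x ∷ p) e k = cong₂ _+_ (cong (x *_) (e k)) (shift-cong (act-cong p e) k)

act-linear : (p : Poly) {h f g : Series} (y : ℕ) → (∀ k → h k ≡ y * f k + g k) →
  ∀ k → act p h k ≡ y * act p f k + act p g k
act-linear [] y e k = sym (cong (_+ 0) (*-zeroʳ y))
act-linear (x ∷ p) {h} {f} {g} y e k = begin
    x * h k + shift (act p h) k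
  ≡⟨ cong₂ _+_ (cong (x *_) (e k)) (shift-linear y (act-linear p y e) k) ⟩
    x * (y * f k + g k) + (y * shift (act p f) k + shift (act p g) k)
  ≡⟨ solve 6 (λ x y a b c d → x :* (y :* a :+ b) :+ (y :* c :+ d) := y :* (x :* a :+ c) :+ (x :* b :+ d))
       refl x y (f k) (g k) (shift (act p f) k) (shift (act p g) k) ⟩
    y * (x * f k + shift (act p f) k) + (x * g k + shift (act p g) k) ∎
  where open ≡-Reasoning

act-shift : (p : Poly) (f : Series) → act p (shift f) ≗ shift (act p f)
act-shift [] f zero = refl
act-shift [] f (suc k) = refl
act-shift (x ∷ p) f zero = cong (_+ 0) (*-zeroʳ x)
act-shift (x ∷ p) f (suc k) = cong (x * f k +_) (act-shift p f k)

act-zero : (p : Poly) → act p (λ _ → 0) ≗ λ _ → 0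
act-zero [] k = refl
act-zero (x ∷ p) k = trans (cong₂ _+_ (*-zeroʳ x) (shift-cong (act-zero p) k)) (shift-zero k)

act-⊕ : (p q : Poly) (f : Series) → ∀ k → act (p ⊕ q) f k ≡ act p f k + act q f k
act-⊕ [] q f k = refl
act-⊕ (x ∷ p) [] f k = sym (+-identityʳ _)
act-⊕ (x ∷ p) (y ∷ q) f k = begin
    (x + y) * f k + shift (act (p ⊕ q) f) k
  ≡⟨ cong ((x + y) * f k +_) (shift-additive (act-⊕ p q f) k) ⟩
    (x + y) * f k + (shift (act p f) k + shift (act q f) k)
  ≡⟨ solve 5 (λ x y a b c → (x :+ y) :* a :+ (b :+ c) := (x :* a :+ b) :+ (y :* a :+ c))
       refl x y (f k) (shift (act p f) k) (shift (act q f) k) ⟩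
    (x * f k + shift (act p f) k) + (y * f k + shift (act q f) k) ∎
  where open ≡-Reasoning

act-scale : (x : ℕ) (p : Poly) (f : Series) → ∀ k → act (map (x *_) p) f k ≡ x * act p f k
act-scale x [] f k = sym (*-zeroʳ x)
act-scale x (y ∷ p) f k = begin
    x * y * f k + shift (act (map (x *_) p) f) k
  ≡⟨ cong (x * y * f k +_) (trans (shift-linear x (λ j → trans (act-scale x p f j) (sym (+-identityʳ _))) k)
                                   (trans (cong (x * shift (act p f) k +_) (shift-zero k)) (+-identityʳ _))) ⟩
    x * y * f k + x * shift (act p f) k
  ≡⟨ solve 4 (λ x y a b → x :* y :* a :+ x :* b := x :* (y :* a :+ b)) refl x y (f k) (shift (act p f) k) ⟩
    x * (y * f k + shift (act p f) k) ∎
  where open ≡-Reasoning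

act-⊛ : (p q : Poly) (f : Series) → ∀ k → act (p ⊛ q) f k ≡ act p (act q f) k
act-⊛ [] q f k = refl
act-⊛ (x ∷ p) q f k = begin
    act (map (x *_) q ⊕ (0 ∷ (p ⊛ q))) f k
  ≡⟨ act-⊕ (map (x *_) q) (0 ∷ (p ⊛ q)) f k ⟩
    act (map (x *_) q) f k + shift (act (p ⊛ q) f) k
  ≡⟨ cong₂ _+_ (act-scale x q f k) (shift-cong (act-⊛ p q f) k) ⟩
    x * act q f k + shift (act p (act q f)) k ∎
  where open ≡-Reasoning

act-comm : (p q : Poly) (f : Series) → ∀ k → act p (act q f) k ≡ act q (act p f) k
act-comm p [] f k = act-zero p k
act-comm p (y ∷ q) f k = begin
    act p (act (y ∷ q) f) k
  ≡⟨ act-linear p {g = shift (act q f)} y (λ _ → refl) k ⟩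
    y * act p f k + act p (shift (act q f)) k
  ≡⟨ cong (y * act p f k +_) (trans (act-shift p (act q f) k) (shift-cong (act-comm p q f) k)) ⟩
    y * act p f k + shift (act q (act p f)) k ∎
  where open ≡-Reasoning

coeff-act : (p : Poly) → coeff p ≗ act p unit
coeff-act [] k = refl
coeff-act (x ∷ p) zero = sym (trans (+-identityʳ _) (*-identityʳ x))
coeff-act (x ∷ p) (suc k) = trans (coeff-act p k) (sym (cong (_+ act p unit k) (*-zeroʳ x)))

act-qPow : (n : ℕ) (f : Series) → act (qPow n) f ≗ shiftBy n f
act-qPow zero f k = trans (cong (1 * f k +_) (shift-zero k)) (trans (+-identityʳ _) (*-identityˡ _))
act-qPow (suc n) f zero = refl
act-qPow (suc n) f (suc k) = act-qPow n f k

shiftBy-cong : (n : ℕ) {f g : Series} → f ≗ g → shiftBy n f ≗ shiftBy n g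
shiftBy-cong zero e k = e k
shiftBy-cong (suc n) e zero = refl
shiftBy-cong (suc n) e (suc k) = shiftBy-cong n e k

shiftBy-zero : (n : ℕ) → shiftBy n (λ _ → 0) ≗ λ _ → 0
shiftBy-zero zero k = refl
shiftBy-zero (suc n) zero = refl
shiftBy-zero (suc n) (suc k) = shiftBy-zero n k

shiftBy-linear : (n : ℕ) {h f g : Series} (x : ℕ) → (∀ k → h k ≡ x * f k + g k) →
  ∀ k → shiftBy n h k ≡ x * shiftBy n f k + shiftBy n g k
shiftBy-linear zero x e k = e k
shiftBy-linear (suc n) x e zero = sym (cong (_+ 0) (*-zeroʳ x))
shiftBy-linear (suc n) x e (suc k) = shiftBy-linear n x e k

shiftBy-shift : (n : ℕ) (f : Series) → shiftBy n (shift f) ≗ shiftBy (suc n) f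
shiftBy-shift zero f zero = refl
shiftBy-shift zero f (suc k) = refl
shiftBy-shift (suc n) f zero = refl
shiftBy-shift (suc n) f (suc k) = shiftBy-shift n f k

shiftBy-act : (n x : ℕ) (p : Poly) (f : Series) →
  ∀ k → shiftBy n (act (x ∷ p) f) k ≡ x * shiftBy n f k + shiftBy (suc n) (act p f) k
shiftBy-act n x p f k =
  trans (shiftBy-linear n {g = shift (act p f)} x (λ _ → refl) k) (cong (x * shiftBy n f k +_) (shiftBy-shift n (act p f) k))

vecUIP : {n : ℕ} → UIP (Vec ℕ n)
vecUIP = Decidable⇒UIP.≡-irrelevant (≡-dec _≟_)

infixl 6 _+ᵛ_
_+ᵛ_ : {n : ℕ} → Vec ℕ n → Vec ℕ n → Vec ℕ n
_+ᵛ_ = zipWith _+_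

zeros : {n : ℕ} → Vec ℕ n
zeros = replicate _ 0

unitVec : {n : ℕ} → Fin n → Vec ℕ n
unitVec zero = 1 ∷ zeros
unitVec (suc j) = 0 ∷ unitVec j

prefixOnes : {n : ℕ} → Fin (suc n) → Vec ℕ n
prefixOnes zero = zeros
prefixOnes {suc n} (suc j) = 1 ∷ prefixOnes j

suffixSums : {n : ℕ} → Vec ℕ n → Vec ℕ n
suffixSums [] = []
suffixSums (x ∷ xs) = (x + V.sum xs) ∷ suffixSums xs

sum-zeros : {n : ℕ} → V.sum (zeros {n}) ≡ 0
sum-zeros {zero} = refl
sum-zeros {suc n} = sum-zeros {n}

sum-unitVec : {n : ℕ} (j : Fin n) → V.sum (unitVec j) ≡ 1
sum-unitVec {suc n} zero = cong suc (sum-zeros {n})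
sum-unitVec (suc j) = sum-unitVec j

suffixSums-zeros : {n : ℕ} → suffixSums (zeros {n}) ≡ zeros
suffixSums-zeros {zero} = refl
suffixSums-zeros {suc n} = cong₂ _∷_ (sum-zeros {n}) suffixSums-zeros

suffixSums-unitVec : {n : ℕ} (j : Fin n) → suffixSums (unitVec j) ≡ prefixOnes (suc j)
suffixSums-unitVec {suc n} zero = cong₂ _∷_ (cong suc (sum-zeros {n})) suffixSums-zeros
suffixSums-unitVec (suc j) = cong₂ _∷_ (sum-unitVec j) (suffixSums-unitVec j)

+ᵛ-assoc : {n : ℕ} (a b c : Vec ℕ n) → (a +ᵛ b) +ᵛ c ≡ a +ᵛ (b +ᵛ c)
+ᵛ-assoc = zipWith-assoc +-assoc

+ᵛ-identityˡ : {n : ℕ} (a : Vec ℕ n) → zeros +ᵛ a ≡ a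
+ᵛ-identityˡ = zipWith-identityˡ +-identityˡ

+ᵛ-identityʳ : {n : ℕ} (a : Vec ℕ n) → a +ᵛ zeros ≡ a
+ᵛ-identityʳ = zipWith-identityʳ +-identityʳ

smallRow : {n : ℕ} → Fin (suc n) → Vec ℕ n
smallRow zero = zeros
smallRow (suc j) = unitVec j

sum≡0⇒zeros : {n : ℕ} (xs : Vec ℕ n) → V.sum xs ≡ 0 → xs ≡ zeros
sum≡0⇒zeros [] _ = refl
sum≡0⇒zeros (zero ∷ xs) e = cong (0 ∷_) (sum≡0⇒zeros xs e)

sum≤1⇒smallRow : {n : ℕ} (xs : Vec ℕ n) → V.sum xs ≤ 1 → Σ (Fin (suc n)) (λ j → smallRow j ≡ xs)
sum≤1⇒smallRow [] _ = zero , refl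
sum≤1⇒smallRow (zero ∷ xs) h with sum≤1⇒smallRow xs h
... | zero , e = zero , cong (0 ∷_) e
... | suc j , e = suc (suc j) , cong (0 ∷_) e
sum≤1⇒smallRow (suc zero ∷ xs) (s≤s h) = suc zero , cong (1 ∷_) (sym (sum≡0⇒zeros xs (n≤0⇒n≡0 h)))

zeros≢unitVec : {n : ℕ} (j : Fin n) → ¬ zeros ≡ unitVec j
zeros≢unitVec {n} j e = 0≢1+n (trans (sym (sum-zeros {n})) (trans (cong V.sum e) (sum-unitVec j)))

unitVec-injective : {n : ℕ} {i j : Fin n} → unitVec i ≡ unitVec j → i ≡ j
unitVec-injective {i = zero} {zero} _ = refl
unitVec-injective {i = zero} {suc j} ()
unitVec-injective {i = suc i} {zero} ()
unitVec-injective {i = suc i} {suc j} e = cong suc (unitVec-injective (∷-injectiveʳ e))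

smallRow-injective : {n : ℕ} {i j : Fin (suc n)} → smallRow i ≡ smallRow j → i ≡ j
smallRow-injective {i = zero} {zero} _ = refl
smallRow-injective {i = zero} {suc j} e = ⊥-elim (zeros≢unitVec j e)
smallRow-injective {i = suc i} {zero} e = ⊥-elim (zeros≢unitVec i (sym e))
smallRow-injective {i = suc i} {suc j} e = cong suc (unitVec-injective e)

smallRows : {n : ℕ} (P : Vec ℕ n → Set) → (∀ xs → P xs → V.sum xs ≤ 1) →
  Σ (Vec ℕ n) P ↔ (P zeros ⊎ Σ (Fin n) (P ∘ unitVec))
smallRows P h = Σ-reindex vecUIP smallRow smallRow-injective (λ xs p → sum≤1⇒smallRow xs (h xs p))
  ⟨↔⟩ Σ-Fin-suc (P ∘ smallRow)

zeroRow : {n : ℕ} (P : Vec ℕ n → Set) → (∀ xs → P xs → V.sum xs ≡ 0) → Σ (Vec ℕ n) P ↔ P zeros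
zeroRow P h = smallRows P (λ xs p → ≤-trans (≤-reflexive (h xs p)) z≤n)
  ⟨↔⟩ ⊎-dropʳ (λ (j , p) → 1≢0 j p)
  where
  1≢0 : ∀ j → P (unitVec j) → ⊥
  1≢0 j p = 0≢1+n (trans (sym (h _ p)) (sum-unitVec j))

-- A function Φ⁺ → ℕ in triangular form: the row of position i (0-based) lists the
-- multiplicities of the roots α_{i+1} + ⋯ + α_{j+1}, for j = i, …, r − 1.
Tri : ℕ → Set
Tri zero = ⊤
Tri (suc r) = Vec ℕ (suc r) × Tri r

-- For a row starting at position 0: how many of its roots cover positions 1, 2, …
reach : {n : ℕ} → Vec ℕ (suc n) → Vec ℕ n
reach (x ∷ xs) = suffixSums xs

weight : {r : ℕ} → Tri r → Vec ℕ r
weight {zero} _ = []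
weight {suc r} (row , T) = V.sum row ∷ (reach row +ᵛ weight T)

size : {r : ℕ} → Tri r → ℕ
size {zero} _ = 0
size {suc r} (row , T) = V.sum row + size T

-- Decompositions of v − u using k − s roots, where u is the contribution of roots
-- started further to the left.
Completions : (r : ℕ) → Vec ℕ r → Vec ℕ r → ℕ → ℕ → Set
Completions r u v s k = Σ (Tri r) (λ T → (u +ᵛ weight T ≡ v) × (s + size T ≡ k))

-- Completions in the presence of one root from the left covering an unknown initial segment.
WithOpenRoot : (r : ℕ) → Vec ℕ r → ℕ → ℕ → Set
WithOpenRoot r v s k = Σ (Fin (suc r)) (λ j → Completions r (prefixOnes j) v s k)

reach-unitVec : {n : ℕ} (j : Fin (suc n)) → reach (unitVec j) ≡ prefixOnes j
reach-unitVec zero = suffixSums-zeros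
reach-unitVec (suc j) = suffixSums-unitVec j

RowThen : {r : ℕ} (u₀ : ℕ) (u : Vec ℕ r) (v₀ : ℕ) (v : Vec ℕ r) (s k : ℕ) → Vec ℕ (suc r) → Set
RowThen {r} u₀ u v₀ v s k row = (u₀ + V.sum row ≡ v₀) × Completions r (u +ᵛ reach row) v (s + V.sum row) k

peelRow : {r : ℕ} (u₀ : ℕ) (u : Vec ℕ r) (v₀ : ℕ) (v : Vec ℕ r) (s k : ℕ) →
  Completions (suc r) (u₀ ∷ u) (v₀ ∷ v) s k ↔ Σ (Vec ℕ (suc r)) (RowThen u₀ u v₀ v s k)
peelRow {r} u₀ u v₀ v s k = mk↔ₛ′ to from to∘from from∘to
  where
  to : Completions (suc r) (u₀ ∷ u) (v₀ ∷ v) s k → Σ (Vec ℕ (suc r)) (RowThen u₀ u v₀ v s k)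
  to ((row , T) , e₁ , e₂) = row , ∷-injectiveˡ e₁ , T ,
    trans (+ᵛ-assoc u (reach row) (weight T)) (∷-injectiveʳ e₁) , trans (+-assoc s (V.sum row) (size T)) e₂
  from : Σ (Vec ℕ (suc r)) (RowThen u₀ u v₀ v s k) → Completions (suc r) (u₀ ∷ u) (v₀ ∷ v) s k
  from (row , e₀ , T , e₁ , e₂) = (row , T) ,
    cong₂ _∷_ e₀ (trans (sym (+ᵛ-assoc u (reach row) (weight T))) e₁) ,
    trans (sym (+-assoc s (V.sum row) (size T))) e₂
  to∘from : ∀ y → to (from y) ≡ y
  to∘from (row , e₀ , T , e₁ , e₂) =
    cong₂ (λ a b → row , a , T , b) (≡-irrelevant _ _) (cong₂ _,_ (vecUIP _ _) (≡-irrelevant _ _))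
  from∘to : ∀ x → from (to x) ≡ x
  from∘to ((row , T) , e₁ , e₂) = cong ((row , T) ,_) (cong₂ _,_ (vecUIP _ _) (≡-irrelevant _ _))

-- A position that must receive 1 and is already covered by a root from the left
-- starts no root.
coveredOne : {r : ℕ} (u v : Vec ℕ r) (s k : ℕ) → Completions (suc r) (1 ∷ u) (1 ∷ v) s k ↔ Completions r u v s k
coveredOne {r} u v s k =
  peelRow 1 u 1 v s k ⟨↔⟩
  zeroRow (RowThen 1 u 1 v s k) (λ row p → suc-injective (proj₁ p)) ⟨↔⟩
  drop-≡ (cong suc (sum-zeros {suc r})) ⟨↔⟩
  ≡⇒↔ (cong₂ (λ w t → Completions r w v t k)
    (trans (cong (u +ᵛ_) suffixSums-zeros) (+ᵛ-identityʳ u)) (trans (cong (s +_) (sum-zeros {suc r})) (+-identityʳ s)))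

-- A position that must receive 1 and is not covered from the left starts exactly one
-- root, which then becomes the open root.
uncoveredOne : {r : ℕ} (v : Vec ℕ r) (s k : ℕ) → Completions (suc r) zeros (1 ∷ v) s k ↔ WithOpenRoot r v (suc s) k
uncoveredOne {r} v s k =
  peelRow 0 zeros 1 v s k ⟨↔⟩
  smallRows (RowThen 0 zeros 1 v s k) (λ row p → ≤-reflexive (proj₁ p)) ⟨↔⟩
  ⊎-dropˡ (λ p → 0≢1+n (trans (sym (sum-zeros {suc r})) (proj₁ p))) ⟨↔⟩
  Σ-congʳ (λ {j} → drop-≡ (sum-unitVec j) ⟨↔⟩
    ≡⇒↔ (cong₂ (λ w t → Completions r w v t k)
      (trans (+ᵛ-identityˡ _) (reach-unitVec j)) (trans (cong (s +_) (sum-unitVec j)) (+-comm s 1))))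

-- A coefficient 1 with an open root: the open root either ends before it (and a new
-- one starts here, contributing a root) or covers it.  This is the factor 1 + q.
openOne : {r : ℕ} (v : Vec ℕ r) (s k : ℕ) →
  WithOpenRoot (suc r) (1 ∷ v) s k ↔ (WithOpenRoot r v (suc s) k ⊎ WithOpenRoot r v s k)
openOne v s k = Σ-Fin-suc _ ⟨↔⟩ ⊎-cong (uncoveredOne v s k) (Σ-congʳ (λ {j} → coveredOne (prefixOnes j) v s k))

carryBound : {r : ℕ} {a : ℕ} {u v : Vec ℕ r} {s k : ℕ} → Completions (suc r) (a ∷ u) (1 ∷ v) s k → a ≤ 1
carryBound {a = a} ((row , T) , e , _) = subst (a ≤_) (∷-injectiveˡ e) (m≤m+n a (V.sum row))

fixHead : {n : ℕ} (u₀ t b c : ℕ) → b + t ≡ c → {w w′ v : Vec ℕ n} → w ≡ w′ → (s k : ℕ) →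
  Σ ℕ (λ x → (u₀ + (x + t) ≡ u₀ + c) × Completions n w v (s + (x + t)) k) ↔ Completions n w′ v (s + c) k
fixHead {n} u₀ t b c bt≡c {w} {w′} {v} w≡w′ s k =
  Σ-congʳ (λ {x} → ×-cong (≡-prop-↔ (solveHead x)
                                     (λ x≡b → cong (λ y → u₀ + (y + t)) x≡b ∙ cong (u₀ +_) bt≡c))
                           (≡⇒↔ (cong (λ w″ → Completions n w″ v (s + (x + t)) k) w≡w′))) ⟨↔⟩
  Σ-singleton {R = λ x → Completions n w′ v (s + (x + t)) k} ⟨↔⟩
  ≡⇒↔ (cong (λ c′ → Completions n w′ v (s + c′) k) bt≡c)
  where
  _∙_ : {a b c : ℕ} → a ≡ b → b ≡ c → a ≡ c
  _∙_ = trans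
  solveHead : (x : ℕ) → u₀ + (x + t) ≡ u₀ + c → x ≡ b
  solveHead x e = +-cancelʳ-≡ t x b (+-cancelˡ-≡ u₀ (x + t) (b + t) (e ∙ cong (u₀ +_) (sym bt≡c)))

-- At a peak followed by a position already covered from the left, all roots
-- starting at the peak have length one.
nextCovered : {r : ℕ} (u₀ : ℕ) (u v : Vec ℕ r) (a s k : ℕ) →
  Completions (suc (suc r)) (u₀ ∷ 1 ∷ u) ((u₀ + a) ∷ 1 ∷ v) s k ↔ Completions (suc r) (1 ∷ u) (1 ∷ v) (s + a) k
nextCovered {r} u₀ u v a s k =
  peelRow u₀ (1 ∷ u) (u₀ + a) (1 ∷ v) s k ⟨↔⟩
  Σ-Vec-suc (RowThen u₀ (1 ∷ u) (u₀ + a) (1 ∷ v) s k) ⟨↔⟩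
  Σ-congʳ (λ {x} → zeroRow (λ xs → RowThen u₀ (1 ∷ u) (u₀ + a) (1 ∷ v) s k (x ∷ xs)) tailVanishes) ⟨↔⟩
  fixHead u₀ (V.sum (zeros {suc r})) a a (trans (cong (a +_) (sum-zeros {suc r})) (+-identityʳ a))
    (trans (cong ((1 ∷ u) +ᵛ_) suffixSums-zeros) (+ᵛ-identityʳ (1 ∷ u))) s k
  where
  tailVanishes : {x : ℕ} (xs : Vec ℕ (suc r)) →
    RowThen u₀ (1 ∷ u) (u₀ + a) (1 ∷ v) s k (x ∷ xs) → V.sum xs ≡ 0
  tailVanishes {x} (y ∷ ys) (_ , completion) =
    n≤0⇒n≡0 (≤-pred (carryBound {s = s + V.sum (x ∷ y ∷ ys)} {k} completion))

-- At a peak followed by a position not covered from the left, either all roots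
-- starting at the peak have length one, or exactly one of them continues and becomes
-- the open root.
nextUncovered : {r : ℕ} (u₀ : ℕ) (v : Vec ℕ r) (a s k : ℕ) →
  Completions (suc (suc r)) (u₀ ∷ zeros) ((u₀ + suc a) ∷ 1 ∷ v) s k ↔ WithOpenRoot (suc r) (1 ∷ v) (s + suc a) k
nextUncovered {r} u₀ v a s k =
  peelRow u₀ zeros (u₀ + suc a) (1 ∷ v) s k ⟨↔⟩
  Σ-Vec-suc P ⟨↔⟩
  Σ-congʳ (λ {x} → smallRows (λ xs → P (x ∷ xs)) tailBound) ⟨↔⟩
  Σ-distribˡ-⊎ ⟨↔⟩
  ⊎-cong (fixHead u₀ (V.sum (zeros {suc r})) (suc a) (suc a)
            (trans (cong (suc a +_) (sum-zeros {suc r})) (+-identityʳ (suc a)))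
            (trans (+ᵛ-identityˡ _) suffixSums-zeros) s k)
         (∃∃↔∃∃ (λ x j → P (x ∷ unitVec j)) ⟨↔⟩
          Σ-congʳ (λ {j} → fixHead u₀ (V.sum (unitVec j)) a (suc a)
            (trans (cong (a +_) (sum-unitVec j)) (+-comm a 1))
            (trans (+ᵛ-identityˡ _) (suffixSums-unitVec j)) s k)) ⟨↔⟩
  ↔-sym (Σ-Fin-suc (λ j → Completions (suc r) (prefixOnes j) (1 ∷ v) (s + suc a) k))
  where
  P : Vec ℕ (suc (suc r)) → Set
  P = RowThen u₀ zeros (u₀ + suc a) (1 ∷ v) s k
  tailBound : {x : ℕ} (xs : Vec ℕ (suc r)) → P (x ∷ xs) → V.sum xs ≤ 1
  tailBound {x} (y ∷ ys) (_ , completion) = carryBound {s = s + V.sum (x ∷ y ∷ ys)} {k} completion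

-- A peak c + 2 followed by 1, with an open root: the five cases give
-- q^{c+1} (2 + 2q + q²).
openPeak : {r : ℕ} (c : ℕ) (v : Vec ℕ r) (s k : ℕ) →
  WithOpenRoot (suc (suc r)) (suc (suc c) ∷ 1 ∷ v) s k ↔
  ((WithOpenRoot r v (suc (s + suc (suc c))) k ⊎ WithOpenRoot r v (s + suc (suc c)) k) ⊎
   ((WithOpenRoot r v (suc (s + suc c)) k ⊎ WithOpenRoot r v (s + suc c) k) ⊎ WithOpenRoot r v (s + suc c) k))
openPeak c v s k =
  Σ-Fin-suc _ ⟨↔⟩
  ⊎-cong (nextUncovered 0 v (suc c) s k ⟨↔⟩ openOne v (s + suc (suc c)) k)
    (Σ-Fin-suc _ ⟨↔⟩
     ⊎-cong (nextUncovered 1 v c s k ⟨↔⟩ openOne v (s + suc c) k)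
       (Σ-congʳ (λ {m} → nextCovered 1 (prefixOnes m) v (suc c) s k ⟨↔⟩ coveredOne (prefixOnes m) v (s + suc c) k)))

shiftRoot : {r : ℕ} → Fin r × Fin r → Fin (suc r) × Fin (suc r)
shiftRoot (i , j) = suc i , suc j

rootsFrom : (r : ℕ) → Fin r → List (Fin r × Fin r)
rootsFrom r i = map (i ,_) (filter (λ j → toℕ i ≤? toℕ j) (allFin r))

allFin-suc : (r : ℕ) → allFin (suc r) ≡ zero ∷ map suc (allFin r)
allFin-suc r = cong (zero ∷_) (sym (map-tabulate id suc))

filter-suc : {r : ℕ} (a : ℕ) (js : List (Fin r)) →
  filter (λ j → suc a ≤? toℕ j) (map suc js) ≡ map suc (filter (λ j → a ≤? toℕ j) js)
filter-suc a [] = refl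
filter-suc a (j ∷ js) with a ≤? toℕ j
... | yes a≤j = begin
    filter (λ j → suc a ≤? toℕ j) (suc j ∷ map suc js)
  ≡⟨ filter-accept (λ j → suc a ≤? toℕ j) (s≤s a≤j) ⟩
    suc j ∷ filter (λ j → suc a ≤? toℕ j) (map suc js)
  ≡⟨ cong (suc j ∷_) (filter-suc a js) ⟩
    map suc (j ∷ filter (λ j → a ≤? toℕ j) js)
  ≡⟨ cong (map suc) (sym (filter-accept (λ j → a ≤? toℕ j) a≤j)) ⟩
    map suc (filter (λ j → a ≤? toℕ j) (j ∷ js)) ∎
  where open ≡-Reasoning
... | no a≰j = begin
    filter (λ j → suc a ≤? toℕ j) (suc j ∷ map suc js)
  ≡⟨ filter-reject (λ j → suc a ≤? toℕ j) (a≰j ∘ ≤-pred) ⟩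
    filter (λ j → suc a ≤? toℕ j) (map suc js)
  ≡⟨ filter-suc a js ⟩
    map suc (filter (λ j → a ≤? toℕ j) js)
  ≡⟨ cong (map suc) (sym (filter-reject (λ j → a ≤? toℕ j) a≰j)) ⟩
    map suc (filter (λ j → a ≤? toℕ j) (j ∷ js)) ∎
  where open ≡-Reasoning

rootsFrom-zero : (r : ℕ) → rootsFrom (suc r) zero ≡ map (zero ,_) (allFin (suc r))
rootsFrom-zero r = cong (map (zero ,_)) (filter-all (λ j → 0 ≤? toℕ j) (universal (λ _ → z≤n) _))

rootsFrom-suc : (r : ℕ) (i : Fin r) → rootsFrom (suc r) (suc i) ≡ map shiftRoot (rootsFrom r i)
rootsFrom-suc r i = begin
    map (suc i ,_) (filter (λ j → suc (toℕ i) ≤? toℕ j) (allFin (suc r)))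
  ≡⟨ cong (map (suc i ,_) ∘ filter (λ j → suc (toℕ i) ≤? toℕ j)) (allFin-suc r) ⟩
    map (suc i ,_) (filter (λ j → suc (toℕ i) ≤? toℕ j) (map suc (allFin r)))
  ≡⟨ cong (map (suc i ,_)) (filter-suc (toℕ i) (allFin r)) ⟩
    map (suc i ,_) (map suc (filter (λ j → toℕ i ≤? toℕ j) (allFin r)))
  ≡⟨ sym (map-∘ _) ⟩
    map (λ j → suc i , suc j) (filter (λ j → toℕ i ≤? toℕ j) (allFin r))
  ≡⟨ map-∘ _ ⟩
    map shiftRoot (rootsFrom r i) ∎
  where open ≡-Reasoning

posRoots-suc : (r : ℕ) → posRoots (suc r) ≡ map (zero ,_) (allFin (suc r)) ++ map shiftRoot (posRoots r)
posRoots-suc r = cong₂ _++_ (rootsFrom-zero r) (begin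
    concatMap (rootsFrom (suc r)) (L.tabulate suc)
  ≡⟨ cong (concatMap (rootsFrom (suc r))) (sym (map-tabulate id suc)) ⟩
    concatMap (rootsFrom (suc r)) (map suc (allFin r))
  ≡⟨ concatMap-map (rootsFrom (suc r)) suc (allFin r) ⟩
    concatMap (rootsFrom (suc r) ∘ suc) (allFin r)
  ≡⟨ concatMap-cong (rootsFrom-suc r) (allFin r) ⟩
    concatMap (map shiftRoot ∘ rootsFrom r) (allFin r)
  ≡⟨ sym (map-concatMap shiftRoot (rootsFrom r) (allFin r)) ⟩
    map shiftRoot (posRoots r) ∎)
  where open ≡-Reasoning

coverage : {r : ℕ} → List (Fin r × Fin r) → List ℕ → Fin r → ℕ
coverage rs ms p = sum (L.zipWith (λ α m → m * rootCoeff α p) rs ms)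

coverage-++ : {r : ℕ} (rs rs′ : List (Fin r × Fin r)) (ms ms′ : List ℕ) (p : Fin r) → length rs ≡ length ms →
  coverage (rs ++ rs′) (ms ++ ms′) p ≡ coverage rs ms p + coverage rs′ ms′ p
coverage-++ [] rs′ [] ms′ p _ = refl
coverage-++ (α ∷ rs) rs′ (m ∷ ms) ms′ p e =
  trans (cong (m * rootCoeff α p +_) (coverage-++ rs rs′ ms ms′ p (suc-injective e)))
        (sym (+-assoc (m * rootCoeff α p) (coverage rs ms p) (coverage rs′ ms′ p)))

≤ᵇ-suc : (a b : ℕ) → (suc a ≤ᵇ suc b) ≡ (a ≤ᵇ b)
≤ᵇ-suc zero b = refl
≤ᵇ-suc (suc a) b = refl

rootCoeff-shift : {r : ℕ} (α : Fin r × Fin r) (p : Fin r) → rootCoeff (shiftRoot α) (suc p) ≡ rootCoeff α p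
rootCoeff-shift (i , j) p rewrite ≤ᵇ-suc (toℕ i) (toℕ p) | ≤ᵇ-suc (toℕ p) (toℕ j) = refl

coverage-shift : {r : ℕ} (rs : List (Fin r × Fin r)) (ms : List ℕ) (p : Fin r) →
  coverage (map shiftRoot rs) ms (suc p) ≡ coverage rs ms p
coverage-shift [] ms p = refl
coverage-shift (α ∷ rs) [] p = refl
coverage-shift (α ∷ rs) (m ∷ ms) p = cong₂ _+_ (cong (m *_) (rootCoeff-shift α p)) (coverage-shift rs ms p)

coverage-shift-zero : {r : ℕ} (rs : List (Fin r × Fin r)) (ms : List ℕ) → coverage (map shiftRoot rs) ms zero ≡ 0
coverage-shift-zero [] ms = refl
coverage-shift-zero (α ∷ rs) [] = refl
coverage-shift-zero (α ∷ rs) (m ∷ ms) = cong₂ _+_ (*-zeroʳ m) (coverage-shift-zero rs ms)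

dot : {n : ℕ} → Vec ℕ n → (Fin n → ℕ) → ℕ
dot [] c = 0
dot (x ∷ xs) c = x * c zero + dot xs (c ∘ suc)

dot-cong : {n : ℕ} (xs : Vec ℕ n) {c c′ : Fin n → ℕ} → (∀ j → c j ≡ c′ j) → dot xs c ≡ dot xs c′
dot-cong [] e = refl
dot-cong (x ∷ xs) e = cong₂ _+_ (cong (x *_) (e zero)) (dot-cong xs (e ∘ suc))

dot-ones : {n : ℕ} (xs : Vec ℕ n) → dot xs (λ _ → 1) ≡ V.sum xs
dot-ones [] = refl
dot-ones (x ∷ xs) = cong₂ _+_ (*-identityʳ x) (dot-ones xs)

dot-suffix : {n : ℕ} (xs : Vec ℕ n) (p : Fin n) →
  dot xs (λ j → if toℕ p ≤ᵇ toℕ j then 1 else 0) ≡ lookup (suffixSums xs) p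
dot-suffix (x ∷ xs) zero = cong₂ _+_ (*-identityʳ x) (dot-ones xs)
dot-suffix (x ∷ xs) (suc p) = cong₂ _+_ (*-zeroʳ x)
  (trans (dot-cong xs (λ j → cong (λ b → if b then 1 else 0) (≤ᵇ-suc (toℕ p) (toℕ j)))) (dot-suffix xs p))

coverage-tabulate : {n r : ℕ} (g : Fin n → Fin r × Fin r) (xs : Vec ℕ n) (p : Fin r) →
  coverage (L.tabulate g) (toList xs) p ≡ dot xs (λ j → rootCoeff (g j) p)
coverage-tabulate g [] p = refl
coverage-tabulate g (x ∷ xs) p = cong (x * rootCoeff (g zero) p +_) (coverage-tabulate (g ∘ suc) xs p)

firstRow-coverage : {r : ℕ} (row : Vec ℕ (suc r)) (p : Fin (suc r)) →
  coverage (map (zero ,_) (allFin (suc r))) (toList row) p ≡ lookup (V.sum row ∷ reach row) p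
firstRow-coverage {r} row p =
  trans (cong (λ rs → coverage rs (toList row) p) (map-tabulate id (zero ,_)))
        (trans (coverage-tabulate (zero ,_) row p) (byPosition row p))
  where
  byPosition : (row : Vec ℕ (suc r)) (p : Fin (suc r)) →
    dot row (λ j → rootCoeff (zero , j) p) ≡ lookup (V.sum row ∷ reach row) p
  byPosition row zero = dot-ones row
  byPosition (x ∷ xs) (suc q) = cong₂ _+_ (*-zeroʳ x)
    (trans (dot-cong xs (λ j → cong (λ b → if b then 1 else 0) (≤ᵇ-suc (toℕ q) (toℕ j)))) (dot-suffix xs q))

triSize : ℕ → ℕ
triSize zero = 0
triSize (suc r) = suc r + triSize r

flatten : {r : ℕ} → Tri r → Vec ℕ (triSize r)
flatten {zero} _ = []
flatten {suc r} (row , T) = row V.++ flatten T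

unflatten : {r : ℕ} → Vec ℕ (triSize r) → Tri r
unflatten {zero} _ = _
unflatten {suc r} xs = take (suc r) xs , unflatten {r} (drop (suc r) xs)

flatten-unflatten : {r : ℕ} (xs : Vec ℕ (triSize r)) → flatten (unflatten {r} xs) ≡ xs
flatten-unflatten {zero} [] = refl
flatten-unflatten {suc r} xs =
  trans (cong (take (suc r) xs V.++_) (flatten-unflatten {r} (drop (suc r) xs))) (take++drop≡id (suc r) xs)

unflatten-flatten : {r : ℕ} (T : Tri r) → unflatten (flatten T) ≡ T
unflatten-flatten {zero} _ = refl
unflatten-flatten {suc r} (row , T) with ++-injective (take (suc r) (row V.++ flatten T)) row
                                                     (take++drop≡id (suc r) (row V.++ flatten T))
... | take≡row , drop≡rest = cong₂ _,_ take≡row (trans (cong (unflatten {r}) drop≡rest) (unflatten-flatten T))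

Tri↔Vec : {r : ℕ} → Tri r ↔ Vec ℕ (triSize r)
Tri↔Vec {r} = mk↔ₛ′ flatten unflatten (flatten-unflatten {r}) unflatten-flatten

length-posRoots : (r : ℕ) → length (posRoots r) ≡ triSize r
length-posRoots zero = refl
length-posRoots (suc r) = begin
    length (posRoots (suc r))
  ≡⟨ cong length (posRoots-suc r) ⟩
    length (map (zero ,_) (allFin (suc r)) ++ map shiftRoot (posRoots r))
  ≡⟨ length-++ (map (zero ,_) (allFin (suc r))) ⟩
    length (map (zero ,_) (allFin (suc r))) + length (map shiftRoot (posRoots r))
  ≡⟨ cong₂ _+_ (trans (length-map _ (allFin (suc r))) (length-tabulate id))
               (trans (length-map shiftRoot (posRoots r)) (length-posRoots r)) ⟩
    suc r + triSize r ∎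
  where open ≡-Reasoning

coverage-flatten : {r : ℕ} (T : Tri r) (p : Fin r) → coverage (posRoots r) (toList (flatten T)) p ≡ lookup (weight T) p
coverage-flatten {suc r} (row , T) p = begin
    coverage (posRoots (suc r)) (toList (row V.++ flatten T)) p
  ≡⟨ cong₂ (λ rs ms → coverage rs ms p) (posRoots-suc r) (toList-++ row (flatten T)) ⟩
    coverage (firstRoots ++ map shiftRoot (posRoots r)) (toList row ++ toList (flatten T)) p
  ≡⟨ coverage-++ firstRoots _ (toList row) _ p
       (trans (length-map _ (allFin (suc r))) (trans (length-tabulate id) (sym (length-toList row)))) ⟩
    coverage firstRoots (toList row) p + coverage (map shiftRoot (posRoots r)) (toList (flatten T)) p
  ≡⟨ byPosition p ⟩
    lookup (weight (row , T)) p ∎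
  where
  open ≡-Reasoning
  firstRoots : List (Fin (suc r) × Fin (suc r))
  firstRoots = map (zero ,_) (allFin (suc r))
  byPosition : (p : Fin (suc r)) →
    coverage firstRoots (toList row) p + coverage (map shiftRoot (posRoots r)) (toList (flatten T)) p ≡
    lookup (weight (row , T)) p
  byPosition zero = trans (cong₂ _+_ (firstRow-coverage row zero) (coverage-shift-zero (posRoots r) _)) (+-identityʳ _)
  byPosition (suc q) = trans (cong₂ _+_ (firstRow-coverage row (suc q))
                                        (trans (coverage-shift (posRoots r) _ q) (coverage-flatten T q)))
                             (sym (lookup-zipWith _+_ q (reach row) (weight T)))

sum-toList : {n : ℕ} (xs : Vec ℕ n) → sum (toList xs) ≡ V.sum xs
sum-toList [] = refl
sum-toList (x ∷ xs) = cong (x +_) (sum-toList xs)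

sum-flatten : {r : ℕ} (T : Tri r) → sum (toList (flatten T)) ≡ size T
sum-flatten {zero} _ = refl
sum-flatten {suc r} (row , T) =
  trans (cong sum (toList-++ row (flatten T)))
        (trans (sum-++ (toList row) (toList (flatten T))) (cong₂ _+_ (sum-toList row) (sum-flatten T)))

toList-≡⇒↔ : {m n : ℕ} (e : m ≡ n) (xs : Vec ℕ m) →
  toList (Inverse.to (≡⇒↔ (cong (Vec ℕ) e)) xs) ≡ toList xs
toList-≡⇒↔ refl xs = refl

RootFun↔Tri : (r : ℕ) → RootFun r ↔ Tri r
RootFun↔Tri r = ≡⇒↔ (cong (Vec ℕ) (length-posRoots r)) ⟨↔⟩ ↔-sym Tri↔Vec

toList-RootFun↔Tri : (r : ℕ) (n : RootFun r) → toList n ≡ toList (flatten (Inverse.to (RootFun↔Tri r) n))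
toList-RootFun↔Tri r n =
  sym (trans (cong toList (flatten-unflatten {r} _)) (toList-≡⇒↔ (length-posRoots r) n))

decompositions↔ : (r : ℕ) (ξ : Vec ℕ r) (k : ℕ) → DecompWith r ξ k ↔ Completions r zeros ξ 0 k
decompositions↔ r ξ k =
  Σ-↔ (RootFun↔Tri r) (λ {n} → ≡⇒↔ (cong₂ (λ w c → (w ≡ ξ) × (c ≡ k)) (weights n) (counts n)))
  where
  T : RootFun r → Tri r
  T = Inverse.to (RootFun↔Tri r)
  weights : (n : RootFun r) → weightOf {r} n ≡ zeros +ᵛ weight (T n)
  weights n = begin
      V.tabulate (coverage (posRoots r) (toList n))
    ≡⟨ cong (V.tabulate ∘ coverage (posRoots r)) (toList-RootFun↔Tri r n) ⟩
      V.tabulate (coverage (posRoots r) (toList (flatten (T n))))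
    ≡⟨ tabulate-cong (coverage-flatten (T n)) ⟩
      V.tabulate (lookup (weight (T n)))
    ≡⟨ tabulate∘lookup (weight (T n)) ⟩
      weight (T n)
    ≡⟨ sym (+ᵛ-identityˡ (weight (T n))) ⟩
      zeros +ᵛ weight (T n) ∎
    where open ≡-Reasoning
  counts : (n : RootFun r) → rootsUsed {r} n ≡ size (T n)
  counts n = trans (cong sum (toList-RootFun↔Tri r n)) (sum-flatten (T n))

onePlusQ : Poly
onePlusQ = 1 ∷ 1 ∷ []

peakPoly : Poly
peakPoly = 2 ∷ 2 ∷ 1 ∷ []

Y : ℕ → ℕ → Series
Y a l = act (onePlusQ ^ₚ a) (act (peakPoly ^ₚ l) unit)

-- one more factor 1 + q, resp. 2 + 2q + q² (the latter by commutativity of the action)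
Y-sucˡ : (a l : ℕ) → Y (suc a) l ≗ act onePlusQ (Y a l)
Y-sucˡ a l = act-⊛ onePlusQ (onePlusQ ^ₚ a) _

Y-sucʳ : (a l : ℕ) → Y a (suc l) ≗ act peakPoly (Y a l)
Y-sucʳ a l k = trans (act-cong (onePlusQ ^ₚ a) (act-⊛ peakPoly (peakPoly ^ₚ l) unit) k)
                     (act-comm (onePlusQ ^ₚ a) peakPoly _ k)

target-Y : (n a l : ℕ) → coeff (qPow n ⊛ ((onePlusQ ^ₚ a) ⊛ (peakPoly ^ₚ l))) ≗ shiftBy n (Y a l)
target-Y n a l k = begin
    coeff (qPow n ⊛ ((onePlusQ ^ₚ a) ⊛ (peakPoly ^ₚ l))) k
  ≡⟨ coeff-act (qPow n ⊛ ((onePlusQ ^ₚ a) ⊛ (peakPoly ^ₚ l))) k ⟩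
    act (qPow n ⊛ ((onePlusQ ^ₚ a) ⊛ (peakPoly ^ₚ l))) unit k
  ≡⟨ act-⊛ (qPow n) _ unit k ⟩
    act (qPow n) (act ((onePlusQ ^ₚ a) ⊛ (peakPoly ^ₚ l)) unit) k
  ≡⟨ act-cong (qPow n) (act-⊛ (onePlusQ ^ₚ a) (peakPoly ^ₚ l) unit) k ⟩
    act (qPow n) (Y a l) k
  ≡⟨ act-qPow n (Y a l) k ⟩
    shiftBy n (Y a l) k ∎
  where open ≡-Reasoning

shiftBy-onePlusQ : (n : ℕ) (f : Series) (k : ℕ) →
  shiftBy n (act onePlusQ f) k ≡ shiftBy (suc n) f k + shiftBy n f k
shiftBy-onePlusQ n f k = begin
    shiftBy n (act onePlusQ f) k
  ≡⟨ shiftBy-act n 1 (1 ∷ []) f k ⟩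
    1 * y₀ + shiftBy (suc n) (act (1 ∷ []) f) k
  ≡⟨ cong (1 * y₀ +_) (trans (shiftBy-act (suc n) 1 [] f k) (cong (1 * y₁ +_) (shiftBy-zero (suc (suc n)) k))) ⟩
    1 * y₀ + (1 * y₁ + 0)
  ≡⟨ solve 2 (λ y₀ y₁ → con 1 :* y₀ :+ (con 1 :* y₁ :+ con 0) := y₁ :+ y₀) refl y₀ y₁ ⟩
    y₁ + y₀ ∎
  where
  open ≡-Reasoning
  y₀ y₁ : ℕ
  y₀ = shiftBy n f k
  y₁ = shiftBy (suc n) f k

shiftBy-peakPoly : (n : ℕ) (f : Series) (k : ℕ) → shiftBy n (act peakPoly f) k ≡
  (shiftBy (suc (suc n)) f k + shiftBy (suc n) f k) + ((shiftBy (suc n) f k + shiftBy n f k) + shiftBy n f k)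
shiftBy-peakPoly n f k = begin
    shiftBy n (act peakPoly f) k
  ≡⟨ shiftBy-act n 2 (2 ∷ 1 ∷ []) f k ⟩
    2 * y₀ + shiftBy (suc n) (act (2 ∷ 1 ∷ []) f) k
  ≡⟨ cong (2 * y₀ +_) (trans (shiftBy-act (suc n) 2 (1 ∷ []) f k) (cong (2 * y₁ +_)
       (trans (shiftBy-act (suc (suc n)) 1 [] f k) (cong (1 * y₂ +_) (shiftBy-zero (3 + n) k))))) ⟩
    2 * y₀ + (2 * y₁ + (1 * y₂ + 0))
  ≡⟨ solve 3 (λ y₀ y₁ y₂ → con 2 :* y₀ :+ (con 2 :* y₁ :+ (con 1 :* y₂ :+ con 0))
                           := (y₂ :+ y₁) :+ ((y₁ :+ y₀) :+ y₀))
       refl y₀ y₁ y₂ ⟩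
    (y₂ + y₁) + ((y₁ + y₀) + y₀) ∎
  where
  open ≡-Reasoning
  y₀ y₁ y₂ : ℕ
  y₀ = shiftBy n f k
  y₁ = shiftBy (suc n) f k
  y₂ = shiftBy (suc (suc n)) f k

-- Blocks v m a l: the peaks contribute m = Σ (c + 1) in total, there are
-- a blocks [1] and l peak blocks.
data Blocks : {r : ℕ} → Vec ℕ r → ℕ → ℕ → ℕ → Set where
  []   : Blocks [] 0 0 0
  one  : {r : ℕ} {v : Vec ℕ r} {m a l : ℕ} → Blocks v m a l → Blocks (1 ∷ v) m (suc a) l
  peak : {r : ℕ} {v : Vec ℕ r} {m a l : ℕ} (c : ℕ) → Blocks v m a l →
         Blocks (suc (suc c) ∷ 1 ∷ v) (suc c + m) a (suc l)

_⊎ᶠ_ : {A B : Set} {a b : ℕ} → A ↔ Fin a → B ↔ Fin b → (A ⊎ B) ↔ Fin (a + b)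
f ⊎ᶠ g = ⊎-cong f g ⟨↔⟩ ↔-sym +↔⊎

-- With no positions left, the open root is forced to be empty and no root is added.
noPositions : (s k : ℕ) → WithOpenRoot 0 [] s k ↔ (s ≡ k)
noPositions s k = mk↔ₛ′ (λ { (zero , _ , _ , e) → trans (sym (+-identityʳ s)) e })
  (λ e → zero , tt , refl , trans (+-identityʳ s) e)
  (λ _ → ≡-irrelevant _ _)
  (λ { (zero , _ , refl , e) → cong (λ e′ → zero , tt , refl , e′) (≡-irrelevant _ _) })

≡↔shiftBy-unit : (n k : ℕ) → (n ≡ k) ↔ Fin (shiftBy n unit k)
≡↔shiftBy-unit zero zero = mk↔ₛ′ (λ _ → zero) (λ _ → refl) (λ { zero → refl }) (λ _ → ≡-irrelevant _ _)
≡↔shiftBy-unit zero (suc k) = mk↔ₛ′ (λ ()) (λ ()) (λ ()) (λ ())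
≡↔shiftBy-unit (suc n) zero = mk↔ₛ′ (λ ()) (λ ()) (λ ()) (λ ())
≡↔shiftBy-unit (suc n) (suc k) = ≡-prop-↔ suc-injective (cong suc) ⟨↔⟩ ≡↔shiftBy-unit n k

count : {r : ℕ} {v : Vec ℕ r} {m a l : ℕ} → Blocks v m a l →
  ∀ s k → WithOpenRoot r v s k ↔ Fin (shiftBy (s + m) (Y a l) k)
count [] s k =
  noPositions s k ⟨↔⟩ ≡↔shiftBy-unit s k ⟨↔⟩
  ≡⇒↔ (cong Fin (trans (shiftBy-cong s (λ j → sym (trans (act-qPow 0 (act (qPow 0) unit) j) (act-qPow 0 unit j))) k)
                       (cong (λ n → shiftBy n (Y 0 0) k) (sym (+-identityʳ s)))))
count {v = 1 ∷ v} {m} {suc a} {l} (one blocks) s k =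
  openOne v s k ⟨↔⟩ (count blocks (suc s) k ⊎ᶠ count blocks s k) ⟨↔⟩
  ≡⇒↔ (cong Fin (sym (trans (shiftBy-cong (s + m) (Y-sucˡ a l) k) (shiftBy-onePlusQ (s + m) (Y a l) k))))
count {v = _ ∷ 1 ∷ v} {_} {a} {suc l} (peak {m = m} c blocks) s k =
  openPeak c v s k ⟨↔⟩
  ((count blocks _ k ⊎ᶠ count blocks _ k) ⊎ᶠ
   ((count blocks _ k ⊎ᶠ count blocks _ k) ⊎ᶠ count blocks _ k)) ⟨↔⟩
  ≡⇒↔ (cong Fin (begin
      (shiftBy (suc (s + suc (suc c)) + m) y k + shiftBy (s + suc (suc c) + m) y k) +
      ((shiftBy (suc (s + suc c) + m) y k + shiftBy (s + suc c + m) y k) + shiftBy (s + suc c + m) y k)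
    ≡⟨ cong₂ _+_ (cong₂ _+_ (at (offset 2 (suc (s + suc (suc c))) (cong suc (+-suc s (suc c)))))
                            (at (offset 1 (s + suc (suc c)) (+-suc s (suc c)))))
                 (cong₂ _+_ (cong₂ _+_ (at (offset 1 (suc (s + suc c)) refl)) (at (offset 0 (s + suc c) refl)))
                            (at (offset 0 (s + suc c) refl))) ⟩
      (shiftBy (suc (suc N)) y k + shiftBy (suc N) y k) + ((shiftBy (suc N) y k + shiftBy N y k) + shiftBy N y k)
    ≡⟨ sym (shiftBy-peakPoly N y k) ⟩
      shiftBy N (act peakPoly y) k
    ≡⟨ sym (shiftBy-cong N (Y-sucʳ a l) k) ⟩
      shiftBy N (Y a (suc l)) k ∎))
  where
  open ≡-Reasoning
  y : Series
  y = Y a l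
  N : ℕ
  N = s + (suc c + m)
  at : {n n′ : ℕ} → n ≡ n′ → shiftBy n y k ≡ shiftBy n′ y k
  at = cong (λ n → shiftBy n y k)
  offset : (i t : ℕ) → t ≡ i + (s + suc c) → t + m ≡ i + N
  offset i t e = trans (cong (_+ m) e) (trans (+-assoc i (s + suc c) m) (cong (i +_) (+-assoc s (suc c) m)))

Gap : ℕ → ℕ → Set
Gap a b = a + 2 ≤ b

gap-trans : {a b c : ℕ} → Gap a b → Gap b c → Gap a c
gap-trans {b = b} ab bc = ≤-trans ab (≤-trans (m≤m+n b 2) bc)

laterIndices : {i : ℕ} {is : List ℕ} → Linked Gap (i ∷ is) → All (Gap i) is
laterIndices [-] = []
laterIndices (g ∷ gaps) = Linked⇒All gap-trans g gaps

≡ᵇ-false : {i p : ℕ} → ¬ i ≡ p → (i ≡ᵇ p) ≡ false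
≡ᵇ-false {i} {p} i≢p = dec-false (i ≟ p) i≢p

cAt-absent : (p : ℕ) (Is cs : List ℕ) → All (p <_) Is → cAt Is cs p ≡ 0
cAt-absent p [] cs _ = refl
cAt-absent p (i ∷ Is) [] _ = refl
cAt-absent p (i ∷ Is) (c ∷ cs) (p<i ∷ later) rewrite ≡ᵇ-false {i} {p} (>⇒≢ p<i) = cAt-absent p Is cs later

xiFrom : (n s : ℕ) → List ℕ → List ℕ → Vec ℕ n
xiFrom zero s Is cs = []
xiFrom (suc n) s Is cs = (1 + cAt Is cs s) ∷ xiFrom n (suc s) Is cs

tabulate-xiFrom : (Is cs : List ℕ) (n s : ℕ) → V.tabulate {n = n} (λ p → 1 + cAt Is cs (s + toℕ p)) ≡ xiFrom n s Is cs
tabulate-xiFrom Is cs zero s = refl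
tabulate-xiFrom Is cs (suc n) s = cong₂ _∷_ (cong (λ t → 1 + cAt Is cs t) (+-identityʳ s))
  (trans (tabulate-cong (λ p → cong (λ t → 1 + cAt Is cs t) (+-suc s (toℕ p)))) (tabulate-xiFrom Is cs n (suc s)))

xiFrom-past : (n s i c : ℕ) (is cs : List ℕ) → i < s → xiFrom n s (i ∷ is) (c ∷ cs) ≡ xiFrom n s is cs
xiFrom-past zero s i c is cs _ = refl
xiFrom-past (suc n) s i c is cs i<s rewrite ≡ᵇ-false {i} {s} (<⇒≢ i<s) =
  cong ((1 + cAt is cs s) ∷_) (xiFrom-past n (suc s) i c is cs (m<n⇒m<1+n i<s))

xiFrom-before : (n s i c : ℕ) (is cs : List ℕ) → s < i → All (Gap i) is →
  xiFrom (suc n) s (i ∷ is) (c ∷ cs) ≡ 1 ∷ xiFrom n (suc s) (i ∷ is) (c ∷ cs)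
xiFrom-before n s i c is cs s<i later rewrite ≡ᵇ-false {i} {s} (>⇒≢ s<i) =
  cong (λ t → suc t ∷ xiFrom n (suc s) (i ∷ is) (c ∷ cs))
       (cAt-absent s is cs (All.map (λ g → <-≤-trans s<i (≤-trans (m≤m+n i 2) g)) later))

-- At an index s with coefficient c the entries are 1 + c and then, by the gap
-- condition, 1.
xiFrom-at : (n s c : ℕ) (is cs : List ℕ) → All (Gap s) is →
  xiFrom (suc (suc n)) s (s ∷ is) (c ∷ cs) ≡ suc c ∷ 1 ∷ xiFrom n (suc (suc s)) is cs
xiFrom-at n s c is cs later
  rewrite dec-true (s ≟ s) refl | ≡ᵇ-false {s} {suc s} (<⇒≢ (n<1+n s))
        | cAt-absent s is cs (All.map (λ g → ≤-trans (≤-trans (n≤1+n (suc s)) (≤-reflexive (+-comm 2 s))) g) later)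
        | cAt-absent (suc s) is cs (All.map (λ g → ≤-trans (≤-reflexive (+-comm 2 s)) g) later)
        | +-identityʳ c =
  cong (λ w → suc c ∷ 1 ∷ w) (xiFrom-past n (suc (suc s)) s c is cs (≤-trans (n<1+n s) (n≤1+n (suc s))))

allOnes : (n s : ℕ) → Blocks (xiFrom n s [] []) 0 n 0
allOnes zero s = []
allOnes (suc n) s = one (allOnes n (suc s))

blocks : (n s : ℕ) (Is cs : List ℕ) → length Is ≡ length cs → Linked Gap Is →
  All (s ≤_) Is → All (λ i → suc i < s + n) Is → All (1 ≤_) cs →
  Σ ℕ (λ a → Blocks (xiFrom n s Is cs) (sum cs) a (length Is))
blocks n s [] [] _ _ _ _ _ = n , allOnes n s
blocks zero s (i ∷ is) (c ∷ cs) _ _ (s≤i ∷ _) (fits ∷ _) _ =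
  ⊥-elim (<⇒≱ (<-trans (n<1+n i) (subst (suc i <_) (+-identityʳ s) fits)) s≤i)
blocks (suc n) s (i ∷ is) (c ∷ cs) e gaps (s≤i ∷ _) fitAll cpos with m≤n⇒m<n∨m≡n s≤i
... | inj₁ s<i with blocks n (suc s) (i ∷ is) (c ∷ cs) e gaps
                      (s<i ∷ All.map (λ g → <-≤-trans s<i (≤-trans (m≤m+n i 2) g)) (laterIndices gaps))
                      (All.map (λ {j} fits → subst (suc j <_) (+-suc s n) fits) fitAll) cpos
...   | a , B = suc a , subst (λ w → Blocks w (sum (c ∷ cs)) (suc a) (length (i ∷ is)))
                          (sym (xiFrom-before n s i c is cs s<i (laterIndices gaps))) (one B)
blocks (suc zero) s (s ∷ is) (c ∷ cs) e gaps _ (fits ∷ _) cpos | inj₂ refl =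
  ⊥-elim (<-irrefl refl (subst (suc s <_) (+-comm s 1) fits))
blocks (suc (suc n)) s (s ∷ is) (zero ∷ cs) e gaps _ _ (() ∷ _) | inj₂ refl
blocks (suc (suc n)) s (s ∷ is) (suc c ∷ cs) e gaps _ (_ ∷ fitAll) (_ ∷ cpos) | inj₂ refl
  with blocks n (suc (suc s)) is cs (suc-injective e) (Linked.tail gaps)
              (All.map (λ {j} g → subst (_≤ j) (+-comm s 2) g) (laterIndices gaps))
              (All.map (λ {j} fits → subst (suc j <_) (trans (+-suc s (suc n)) (cong suc (+-suc s n))) fits) fitAll) cpos
... | a , B = a , subst (λ w → Blocks w (suc c + sum cs) a (suc (length is)))
                    (sym (xiFrom-at n s (suc c) is cs (laterIndices gaps))) (peak c B)

Blocks-length : {r : ℕ} {v : Vec ℕ r} {m a l : ℕ} → Blocks v m a l → a + 2 * l ≡ r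
Blocks-length [] = refl
Blocks-length (one B) = cong suc (Blocks-length B)
Blocks-length {a = a} (peak {l = l} c B) =
  trans (cong (a +_) (*-suc 2 l))
        (trans (+-suc a (suc (2 * l))) (cong suc (trans (+-suc a (2 * l)) (cong suc (Blocks-length B)))))

xi-blocks : (r′ ℓ : ℕ) (I c : Vec ℕ ℓ) → NonconsecIncreasing (toList I) →
  All (λ i → 1 < i) (toList I) → All (λ i → i < suc r′) (toList I) → All (λ x → 1 ≤ x) (toList c) →
  (xi (suc r′) ℓ I c ≡ 1 ∷ xiFrom r′ 2 (toList I) (toList c)) ×
  Blocks (xiFrom r′ 2 (toList I) (toList c)) (sum (toList c)) (r′ ∸ 2 * ℓ) ℓ
xi-blocks r′ ℓ I c gaps lower upper cpos =
  trans (tabulate-xiFrom Is cs (suc r′) 1) (cong (λ t → suc t ∷ xiFrom r′ 2 Is cs) (cAt-absent 1 Is cs lower)) ,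
  subst₂ (Blocks (xiFrom r′ 2 Is cs) (sum cs)) a≡ (length-toList I) B
  where
  Is cs : List ℕ
  Is = toList I
  cs = toList c
  found : Σ ℕ (λ a → Blocks (xiFrom r′ 2 Is cs) (sum cs) a (length Is))
  found = blocks r′ 2 Is cs (trans (length-toList I) (sym (length-toList c))) gaps lower (All.map s≤s upper) cpos
  a : ℕ
  a = proj₁ found
  B : Blocks (xiFrom r′ 2 Is cs) (sum cs) a (length Is)
  B = proj₂ found
  a≡ : a ≡ r′ ∸ 2 * ℓ
  a≡ = sym (trans (cong (λ t → t ∸ 2 * ℓ) (sym (Blocks-length B)))
                  (trans (cong (λ l → a + 2 * l ∸ 2 * ℓ) (length-toList I)) (m+n∸n≡m a (2 * ℓ))))

proposition3p2 : (r ℓ : ℕ) → 3 ≤ r → (I c : Vec ℕ ℓ) →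
    NonconsecIncreasing (toList I) →
    All (λ i → 1 < i) (toList I) → All (λ i → i < r) (toList I) →
    All (λ x → 1 ≤ x) (toList c) →
    (k : ℕ) →
    HasCard (DecompWith r (xi r ℓ I c) k)
      (coeff (qPow (sum (toList c) + 1) ⊛ (((1 ∷ 1 ∷ []) ^ₚ (r ∸ 1 ∸ 2 * ℓ)) ⊛ ((2 ∷ 2 ∷ 1 ∷ []) ^ₚ ℓ))) k)
proposition3p2 zero ℓ () I c gaps lower upper cpos k
proposition3p2 (suc r′) ℓ _ I c gaps lower upper cpos k with xi-blocks r′ ℓ I c gaps lower upper cpos
... | ξ≡ , shape = ↔-sym (
  decompositions↔ (suc r′) (xi (suc r′) ℓ I c) k ⟨↔⟩
  ≡⇒↔ (cong (λ ξ → Completions (suc r′) zeros ξ 0 k) ξ≡) ⟨↔⟩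
  uncoveredOne _ 0 k ⟨↔⟩
  count shape 1 k ⟨↔⟩
  ≡⇒↔ (cong Fin (trans (cong (λ n → shiftBy n (Y (r′ ∸ 2 * ℓ) ℓ) k) (+-comm 1 (sum (toList c))))
                       (sym (target-Y (sum (toList c) + 1) (r′ ∸ 2 * ℓ) ℓ k)))))
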